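{- Let $G$ be a connected graph of order $n\ge3$ and $S$ a total dominating set of $M(G)$. Then there exists a total dominating set $S'$ of $M(G)$ with $S'\subseteq E(G)$ and $|S'|\le|S|$.
   Context: All graphs are finite and simple. For a graph $H$ with no isolated vertices, a total dominating set of $H$ is a set $S\subseteq V(H)$ such that every vertex of $H$ has at least one neighbor in $S$. The middle graph $M(G)$ of a graph $G$ has vertex set $V(G)\cup E(G)$ (disjoint union), and two of its vertices $x,y$ are adjacent exactly when either $x,y\in E(G)$ are edges of $G$ sharing a common endpoint, or $x\in V(G)$, $y\in E(G)$ and $x$ is an endpoint of $y$ (no two elements of $V(G)$ are adjacent in $M(G)$). Thus $E(G)$ is a subset of the vertex set of $M(G)$. -}

module Defs where

open import Data.Nat using (ℕ)
open import Data.Fin using (Fin; _<_)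
open import Data.Bool using (Bool; true; false)
open import Data.Product using (Σ; ∃; _×_; _,_; proj₁; proj₂)
open import Data.Sum using (_⊎_; inj₁; inj₂)
open import Data.Empty using (⊥)
open import Data.List using (List)
open import Data.List.Membership.Propositional using (_∈_)
open import Relation.Binary.PropositionalEquality using (_≡_; _≢_)

record Graph (n : ℕ) : Set where
  field
    Adj   : Fin n → Fin n → Bool
    sym   : ∀ i j → Adj i j ≡ Adj j i
    irrefl : ∀ i → Adj i i ≡ false
open Graph public

data Walk {n : ℕ} (G : Graph n) : Fin n → Fin n → Set where
  here : ∀ {u} → Walk G u u
  step : ∀ {u w v} → Adj G u w ≡ true → Walk G w v → Walk G u v

Connected : {n : ℕ} → Graph n → Set
Connected G = ∀ u v → Walk G u v

-- Edges of G: each edge {i,j} is represented once, as an ordered pair with i < j.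
Edge : {n : ℕ} → Graph n → Set
Edge {n} G = Σ (Fin n × Fin n) λ p → (proj₁ p < proj₂ p) × (Adj G (proj₁ p) (proj₂ p) ≡ true)

Endpoint : {n : ℕ} (G : Graph n) → Fin n → Edge G → Set
Endpoint G x ((i , j) , _) = (x ≡ i) ⊎ (x ≡ j)

-- Vertex set of the middle graph M(G): V(G) ⊎ E(G)
MVertex : {n : ℕ} → Graph n → Set
MVertex {n} G = Fin n ⊎ Edge G

MAdj : {n : ℕ} (G : Graph n) → MVertex G → MVertex G → Set
MAdj G (inj₁ x) (inj₁ y) = ⊥
MAdj G (inj₁ x) (inj₂ e) = Endpoint G x e
MAdj G (inj₂ e) (inj₁ y) = Endpoint G y e
MAdj G (inj₂ e) (inj₂ f) = (e ≢ f) × ∃ λ x → Endpoint G x e × Endpoint G x f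

TotalDominating : {n : ℕ} (G : Graph n) → List (MVertex G) → Set
TotalDominating G S = ∀ v → ∃ λ u → (u ∈ S) × MAdj G v u

IsEdge : {n : ℕ} {G : Graph n} → MVertex G → Set
IsEdge {G = G} v = ∃ λ (e : Edge G) → v ≡ inj₂ e

-- Every vertex x of G lying in S can be traded for an edge: S contains an
-- edge g incident to x (the only neighbours of x in M(G) are edges), and every
-- edge dominated by x other than g is also dominated by g. Since G is connected
-- with at least three vertices, g meets some other edge e, and replacing x by e
-- keeps S totally dominating; removing duplicates afterwards does not enlarge it.
module Submission where

open import Defs
open import Data.Nat using (ℕ; _≤_; s≤s)
open import Data.Fin using (Fin; zero; suc; _≟_)
open import Data.Fin.Properties using (<-cmp; <-irrelevant)
open import Data.Bool using (true) renaming (_≟_ to _≟ᵇ_)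
open import Data.Product using (Σ; ∃; _×_; _,_; proj₁; proj₂)
open import Data.Product.Properties using () renaming (≡-dec to Σ-≡-dec)
open import Data.Sum using (inj₁; inj₂)
open import Data.Sum.Properties using () renaming (≡-dec to ⊎-≡-dec)
open import Data.Empty using (⊥-elim)
open import Data.List using (List; length; map; deduplicate)
open import Data.List.Relation.Unary.All using (All)
import Data.List.Relation.Unary.All as All
import Data.List.Relation.Unary.All.Properties as All
open import Data.List.Relation.Unary.Unique.Propositional using (Unique)
open import Data.List.Relation.Unary.Unique.DecPropositional.Properties using (deduplicate-!)
open import Data.List.Membership.Propositional using (_∈_)
open import Data.List.Membership.Propositional.Properties
  using (∈-deduplicate⁺; ∈-map⁺)
open import Data.List.Properties using (length-deduplicate; length-map)
open import Data.Nat.Properties using (≤-trans; ≤-reflexive)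
open import Relation.Binary.Definitions using (DecidableEquality; tri<; tri≈; tri>)
open import Relation.Binary.PropositionalEquality using (_≡_; _≢_; refl; cong₂; trans)
  renaming (sym to ≡-sym)
open import Relation.Nullary using (¬_; yes; no)
open import Relation.Unary using (Pred; Decidable)
open import Axiom.UniquenessOfIdentityProofs using (module Decidable⇒UIP)

avoid-two : ∀ {n} → 3 ≤ n → (i j : Fin n) → ∃ λ k → k ≢ i × k ≢ j
avoid-two (s≤s (s≤s (s≤s _))) zero zero              = suc zero , (λ ()) , (λ ())
avoid-two (s≤s (s≤s (s≤s _))) zero (suc zero)        = suc (suc zero) , (λ ()) , (λ ())
avoid-two (s≤s (s≤s (s≤s _))) zero (suc (suc _))     = suc zero , (λ ()) , (λ ())
avoid-two (s≤s (s≤s (s≤s _))) (suc zero) zero        = suc (suc zero) , (λ ()) , (λ ())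
avoid-two (s≤s (s≤s (s≤s _))) (suc (suc _)) zero     = suc zero , (λ ()) , (λ ())
avoid-two (s≤s (s≤s (s≤s _))) (suc _) (suc _)        = zero , (λ ()) , (λ ())

module GraphProperties {n : ℕ} (G : Graph n) where

  walk-leaves : ∀ {p} {P : Pred (Fin n) p} → Decidable P → ∀ {u v} → Walk G u v →
                P u → ¬ P v → ∃ λ x → ∃ λ y → P x × ¬ P y × Adj G x y ≡ true
  walk-leaves P? here Pu ¬Pv = ⊥-elim (¬Pv Pu)
  walk-leaves P? {u} (step {w = w} uw rest) Pu ¬Pv with P? w
  ... | yes Pw = walk-leaves P? rest Pw ¬Pv
  ... | no ¬Pw = u , w , Pu , ¬Pw , uw

  edge-between : ∀ x y → Adj G x y ≡ true → Σ (Edge G) λ e → Endpoint G x e × Endpoint G y e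
  edge-between x y xy with <-cmp x y
  ... | tri< x<y _ _ = ((x , y) , x<y , xy) , inj₁ refl , inj₂ refl
  ... | tri> _ _ y<x = ((y , x) , y<x , trans (Graph.sym G y x) xy) , inj₂ refl , inj₁ refl
  ... | tri≈ _ refl _ with trans (≡-sym (irrefl G x)) xy
  ...   | ()

  Endpoint? : (e : Edge G) → Decidable (λ x → Endpoint G x e)
  Endpoint? ((i , j) , _) x with x ≟ i | x ≟ j
  ... | yes x≡i | _       = yes (inj₁ x≡i)
  ... | no _    | yes x≡j = yes (inj₂ x≡j)
  ... | no x≢i  | no x≢j  = no λ { (inj₁ x≡i) → x≢i x≡i ; (inj₂ x≡j) → x≢j x≡j }

  _≟ᴱ_ : DecidableEquality (Edge G)
  _≟ᴱ_ = Σ-≡-dec (Σ-≡-dec _≟_ _≟_) λ (i<j , ij) (i<j′ , ij′) →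
    yes (cong₂ _,_ (<-irrelevant i<j i<j′) (Decidable⇒UIP.≡-irrelevant _≟ᵇ_ ij ij′))

  _≟ᴹ_ : DecidableEquality (MVertex G)
  _≟ᴹ_ = ⊎-≡-dec _≟_ _≟ᴱ_

  -- A path from an endpoint of g to a vertex k off g must leave g along an edge e ≠ g.
  ∃-adjacent-edge : 3 ≤ n → Connected G → (g : Edge G) → ∃ λ e → MAdj G (inj₂ g) (inj₂ e)
  ∃-adjacent-edge three conn g@((i , j) , _)
    with avoid-two three i j
  ... | k , k≢i , k≢j
    with walk-leaves (Endpoint? g) (conn i k) (inj₁ refl)
                   (λ { (inj₁ k≡i) → k≢i k≡i ; (inj₂ k≡j) → k≢j k≡j })
  ... | x , y , x∈g , y∉g , xy
    with edge-between x y xy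
  ... | e , x∈e , y∈e = e , (λ { refl → y∉g y∈e }) , x , x∈g , x∈e

TotalDominating-mono : ∀ {n} {G : Graph n} {S T : List (MVertex G)} →
                       (∀ {u} → u ∈ S → u ∈ T) → TotalDominating G S → TotalDominating G T
TotalDominating-mono S⊆T td v with td v
... | u , u∈S , vu = u , S⊆T u∈S , vu

module EdgeReplacement {n} {G : Graph n} (three : 3 ≤ n) (conn : Connected G)
                       {S : List (MVertex G)} (td : TotalDominating G S) where

  open GraphProperties G

  -- Missing clauses: vertices of G are pairwise non-adjacent in M(G).
  dominating-edge : (x : Fin n) → Σ (Edge G) λ g → inj₂ g ∈ S × Endpoint G x g
  dominating-edge x with td (inj₁ x)
  ... | inj₂ g , g∈S , x∈g = g , g∈S , x∈g

  dominator : Fin n → Edge G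
  dominator x = proj₁ (dominating-edge x)

  dominator-∈ : ∀ x → inj₂ (dominator x) ∈ S
  dominator-∈ x = proj₁ (proj₂ (dominating-edge x))

  endpoint-dominator : ∀ x → Endpoint G x (dominator x)
  endpoint-dominator x = proj₂ (proj₂ (dominating-edge x))

  partner : Edge G → Edge G
  partner g = proj₁ (∃-adjacent-edge three conn g)

  partner-adjacent : ∀ g → MAdj G (inj₂ g) (inj₂ (partner g))
  partner-adjacent g = proj₂ (∃-adjacent-edge three conn g)

  replace : MVertex G → MVertex G
  replace (inj₁ x) = inj₂ (partner (dominator x))
  replace (inj₂ e) = inj₂ e

  replace-IsEdge : ∀ u → IsEdge {G = G} (replace u)
  replace-IsEdge (inj₁ x) = partner (dominator x) , refl
  replace-IsEdge (inj₂ e) = e , refl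

  replace-TotalDominating : TotalDominating G (map replace S)
  replace-TotalDominating (inj₁ y) with td (inj₁ y)
  ... | inj₂ g , g∈S , y∈g = inj₂ g , ∈-map⁺ replace g∈S , y∈g
  replace-TotalDominating (inj₂ h) with td (inj₂ h)
  ... | inj₂ g , g∈S , hg = inj₂ g , ∈-map⁺ replace g∈S , hg
  ... | inj₁ x , x∈S , x∈h with h ≟ᴱ dominator x
  ...   | no h≢g   = inj₂ (dominator x) , ∈-map⁺ replace (dominator-∈ x) , h≢g , x , x∈h , endpoint-dominator x
  ...   | yes refl = replace (inj₁ x) , ∈-map⁺ replace x∈S , partner-adjacent (dominator x)

lemma2p1 : (n : ℕ) → 3 ≤ n → (G : Graph n) → Connected G →
    (S : List (MVertex G)) → Unique S → TotalDominating G S →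
    Σ (List (MVertex G)) λ S' →
      Unique S' × TotalDominating G S' × All (IsEdge {G = G}) S' × length S' ≤ length S
lemma2p1 n three G conn S _ td =
  deduplicate _≟ᴹ_ (map replace S) ,
  deduplicate-! _≟ᴹ_ (map replace S) ,
  TotalDominating-mono (∈-deduplicate⁺ _≟ᴹ_) replace-TotalDominating ,
  All.deduplicate⁺ _≟ᴹ_ (All.map⁺ (All.universal replace-IsEdge S)) ,
  ≤-trans (length-deduplicate _≟ᴹ_ (map replace S)) (≤-reflexive (length-map replace S))
  where
  open GraphProperties G using (_≟ᴹ_)
  open EdgeReplacement three conn td
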